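{- For every automorphism $\pi\in Aut(I)$, every $k$-orbit-form $(\varphi,G,H)$ and every $k$-molecule $\sigma$ we have $\pi((\varphi,G,H)*\sigma)=(\varphi,G,H)*\pi\sigma$.
   Context: $I$ is a finite set of atoms partitioned into a set $C$ of colours; $Aut(I)$ is the automorphism group of the input structure on $I$, in particular each $\pi\in Aut(I)$ is a permutation of $I$ preserving every colour. Permutations of $I$ act on hereditarily finite sets over $I$ by $\pi(\{b_1,\dots,b_m\})=\{\pi(b_1),\dots,\pi(b_m)\}$; $Sym(I)$ is the group of all permutations of $I$. Fix $k\ge1$. A $k$-molecule is an injective map $\sigma:\{0,\dots,k-1\}\to I$; for a permutation $h$, $h\sigma=h\circ\sigma$. For $k$-molecules $\tau,\sigma$, $\textit{conf}(\tau,\sigma)=(\sim,col)$ where, writing $\rho_0=\tau,\rho_1=\sigma$, $(i,p)\sim(j,q)$ iff $\rho_i(p)=\rho_j(q)$ and $col(i,p)$ is the colour containing $\rho_i(p)$. An abstract 2-configuration is a pair $(\sim,col)$ with $\sim$ an equivalence on $\{0,1\}\times\{0,\dots,k-1\}$ such that $(i,p)\sim(i,q)\iff p=q$, and $col:\{0,1\}\times\{0,\dots,k-1\}\to C$ constant on $\sim$-classes. The $k$-forms are the smallest set containing new symbols $c_0,\dots,c_{k-1}$ and every finite set $\{(\varphi_1,E_1),\dots,(\varphi_n,E_n)\}$ of pairs of $k$-forms $\varphi_i$ and abstract 2-configurations $E_i$. For a $k$-form $\varphi$ and $k$-molecule $\sigma$: $c_p*\sigma=\sigma(p)$, and $\{(\varphi_i,E_i)\mid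 1\le i\le n\}*\sigma=\{\varphi_i*\tau\mid 1\le i\le n,\ \tau\text{ a }k\text{ -molecule with } E_i=\textit{conf}(\tau,\sigma)\}$. A $k$-orbit-form is a triple $(\varphi,G,H)$ with $\varphi$ a $k$-form and $H\subseteq G\subseteq Sym(I)$ groups commuting with $Aut(I)$ (i.e. $\pi G=G\pi$ and $\pi H=H\pi$ for all $\pi\in Aut(I)$). Then $(\varphi,G,H)*\sigma=G\big(\bigcup_{h\in H}\varphi*h\sigma\big)$, where $G(y)=\{g(y)\mid g\in G\}$, and for $\varphi=c_p$ the term $\varphi*h\sigma$ inside the union is read as $\{h\sigma(p)\}$. -}

module Defs where

open import Data.Nat using (ℕ)
open import Data.Fin using (Fin; _≟_)
open import Data.Fin.Patterns using (0F; 1F)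
open import Data.Fin.Permutation using (Permutation′; _⟨$⟩ʳ_; _⟨$⟩ˡ_; inverseˡ; id; flip; _∘ₚ_)
open import Data.Bool using (Bool; true)
open import Data.Product using (Σ; _×_; _,_; ∃)
open import Data.Empty using (⊥)
open import Data.Unit using (⊤; tt)
open import Function.Definitions using (Injective)
open import Relation.Nullary using (does)
open import Relation.Binary.PropositionalEquality using (_≡_; cong; sym; trans)

-- Atoms: I = Fin n, colours: C = Fin m, colour : Fin n → Fin m assigns
-- to each atom the colour (class of the partition) containing it.

Perm : ℕ → Set
Perm n = Permutation′ n

_≈ₚ_ : ∀ {n} → Perm n → Perm n → Set
π ≈ₚ ρ = ∀ i → π ⟨$⟩ʳ i ≡ ρ ⟨$⟩ʳ i

record IsSubgroup {n : ℕ} (G : Perm n → Set) : Set where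
  field
    resp       : ∀ {g h} → g ≈ₚ h → G g → G h
    has-id     : G id
    closed-∘   : ∀ {g h} → G g → G h → G (g ∘ₚ h)
    closed-inv : ∀ {g} → G g → G (flip g)

record AutGroup {n m : ℕ} (colour : Fin n → Fin m) : Set₁ where
  field
    member     : Perm n → Set
    isSubgroup : IsSubgroup member
    preserves  : ∀ π → member π → ∀ i → colour (π ⟨$⟩ʳ i) ≡ colour i

-- π G = G π  (equality of sets of permutations  {π∘g | g∈G} = {g∘π | g∈G})
CommutesWith : ∀ {n} → Perm n → (Perm n → Set) → Set
CommutesWith π G =
  (∀ g → G g → Σ (Perm _) λ g' → G g' × (∀ i → π ⟨$⟩ʳ (g ⟨$⟩ʳ i) ≡ g' ⟨$⟩ʳ (π ⟨$⟩ʳ i)))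
  × (∀ g → G g → Σ (Perm _) λ g' → G g' × (∀ i → g ⟨$⟩ʳ (π ⟨$⟩ʳ i) ≡ π ⟨$⟩ʳ (g' ⟨$⟩ʳ i)))

CommutesWithAut : ∀ {n m} {colour : Fin n → Fin m} → AutGroup colour → (Perm n → Set) → Set
CommutesWithAut A G = ∀ π → AutGroup.member A π → CommutesWith π G

record Molecule (k n : ℕ) : Set where
  constructor mol
  field
    at  : Fin k → Fin n
    inj : Injective _≡_ _≡_ at
open Molecule public

permMol : ∀ {k n} → Perm n → Molecule k n → Molecule k n
permMol h σ = mol (λ p → h ⟨$⟩ʳ at σ p)
  (λ {x} {y} e → inj σ (trans (sym (inverseˡ h)) (trans (cong (h ⟨$⟩ˡ_) e) (inverseˡ h))))

-- abstract 2-configurations (~ given as a Boolean relation on {0,1}×{0..k-1})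

record Conf (k m : ℕ) : Set where
  field
    rel      : Fin 2 → Fin k → Fin 2 → Fin k → Bool
    col      : Fin 2 → Fin k → Fin m
    rel-refl  : ∀ i p → rel i p i p ≡ true
    rel-sym   : ∀ i p j q → rel i p j q ≡ true → rel j q i p ≡ true
    rel-trans : ∀ i p j q l r → rel i p j q ≡ true → rel j q l r ≡ true → rel i p l r ≡ true
    rel-same  : ∀ i p q → rel i p i q ≡ true → p ≡ q
    col-const : ∀ i p j q → rel i p j q ≡ true → col i p ≡ col j q

ρ : ∀ {k n} → Molecule k n → Molecule k n → Fin 2 → Fin k → Fin n
ρ τ σ 0F = at τ
ρ τ σ 1F = at σ

IsConf : ∀ {k n m} → (Fin n → Fin m) → Conf k m → Molecule k n → Molecule k n → Set
IsConf colour E τ σ =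
  (∀ i p j q → Conf.rel E i p j q ≡ does (ρ τ σ i p ≟ ρ τ σ j q))
  × (∀ i p → Conf.col E i p ≡ colour (ρ τ σ i p))

-- k-forms: c_p, or a finite set {(φ_1,E_1),…,(φ_r,E_r)}

data Form (k m : ℕ) : Set where
  c   : Fin k → Form k m
  set : (r : ℕ) → (Fin r → Form k m) → (Fin r → Conf k m) → Form k m

-- (hereditarily finite) sets over the atoms I, Aczel-style, with
-- extensional equality _≃_

data V (n : ℕ) : Set₁ where
  atom : Fin n → V n
  sup  : (A : Set) → (A → V n) → V n

_≃_ : ∀ {n} → V n → V n → Set
atom i  ≃ atom j  = i ≡ j
atom _  ≃ sup _ _ = ⊥
sup _ _ ≃ atom _  = ⊥
sup A f ≃ sup B g = (∀ a → Σ B λ b → f a ≃ g b) × (∀ b → Σ A λ a → f a ≃ g b)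

act : ∀ {n} → Perm n → V n → V n
act π (atom i)  = atom (π ⟨$⟩ʳ i)
act π (sup A f) = sup A (λ a → act π (f a))

star : ∀ {k n m} → (Fin n → Fin m) → Form k m → Molecule k n → V n
star colour (c p) σ = atom (at σ p)
star colour (set r φ E) σ =
  sup (Σ (Fin r) λ i → Σ (Molecule _ _) λ τ → IsConf colour (E i) τ σ)
      (λ { (i , τ , _) → star colour (φ i) τ })

-- elements of a set; an atom a is read as the singleton {a}
Elems : ∀ {n} → V n → Set
Elems (atom _)  = ⊤
Elems (sup A _) = A

elem : ∀ {n} → (x : V n) → Elems x → V n
elem (atom a)  _ = atom a
elem (sup A f) e = f e

record OrbitForm (k : ℕ) {n m : ℕ} {colour : Fin n → Fin m} (A : AutGroup colour) : Set₁ where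
  field
    φ      : Form k m
    G      : Perm n → Set
    H      : Perm n → Set
    G-grp  : IsSubgroup G
    H-grp  : IsSubgroup H
    H⊆G    : ∀ h → H h → G h
    G-comm : CommutesWithAut A G
    H-comm : CommutesWithAut A H

-- (φ,G,H) * σ = G( ⋃_{h ∈ H} φ * hσ )
orbitStar : ∀ {k n m} {colour : Fin n → Fin m} {A : AutGroup colour} →
            OrbitForm k A → Molecule k n → V n
orbitStar {colour = colour} O σ =
  sup (Σ (Perm _) G) (λ { (g , _) → act g U })
  where
    open OrbitForm O
    U : V _
    U = sup (Σ (Σ (Perm _) H) λ { (h , _) → Elems (star colour φ (permMol h σ)) })
            (λ { ((h , _) , e) → elem (star colour φ (permMol h σ)) e })

module Submission where

open import Defs
open import Level using (0ℓ) renaming (suc to lsuc)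
open import Data.Nat using (ℕ; _≤_)
open import Data.Fin using (Fin; _≟_)
open import Data.Fin.Patterns using (0F; 1F)
open import Data.Fin.Permutation using (_⟨$⟩ʳ_; _⟨$⟩ˡ_; inverseˡ; inverseʳ; flip)
open import Data.Product using (Σ; _,_; proj₁; proj₂)
open import Data.Unit using (tt)
open import Function using (_∘_)
open import Function.Bundles using (Injection; mk⇔)
open import Function.Properties.Inverse using (↔⇒↣)
open import Relation.Binary.Bundles using (Setoid)
open import Relation.Nullary.Decidable using (does; does-⇔)
open import Relation.Binary.PropositionalEquality using (_≡_; refl; cong; cong₂; sym; trans)

-- A colour-preserving permutation π maps conf(τ, σ) to
-- conf(πτ, πσ) unchanged, so by induction on forms φ * πσ = π(φ * σ).
-- For an orbit-form, π h = h' π and π g = g' π with h' ∈ H, g' ∈ G,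
-- so π merely reindexes the union over H and the orbit over G.

module _ {n : ℕ} where

  ≃-refl : (x : V n) → x ≃ x
  ≃-refl (atom i)  = refl
  ≃-refl (sup A f) = (λ a → a , ≃-refl (f a)) , (λ a → a , ≃-refl (f a))

  ≃-sym : (x y : V n) → x ≃ y → y ≃ x
  ≃-sym (atom i)  (atom j)  i≡j = sym i≡j
  ≃-sym (sup A f) (sup B g) (f⊆g , g⊆f) =
    (λ b → let (a , fa≃gb) = g⊆f b in a , ≃-sym (f a) (g b) fa≃gb) ,
    (λ a → let (b , fa≃gb) = f⊆g a in b , ≃-sym (f a) (g b) fa≃gb)

  ≃-trans : (x y z : V n) → x ≃ y → y ≃ z → x ≃ z
  ≃-trans (atom i)  (atom j)  (atom l)  i≡j j≡l = trans i≡j j≡l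
  ≃-trans (sup A f) (sup B g) (sup C h) (f⊆g , g⊆f) (g⊆h , h⊆g) =
    (λ a → let (b , fa≃gb) = f⊆g a ; (z , gb≃hz) = g⊆h b
           in z , ≃-trans (f a) (g b) (h z) fa≃gb gb≃hz) ,
    (λ z → let (b , gb≃hz) = h⊆g z ; (a , fa≃gb) = g⊆f b
           in a , ≃-trans (f a) (g b) (h z) fa≃gb gb≃hz)

  V-setoid : Setoid (lsuc 0ℓ) 0ℓ
  V-setoid = record
    { Carrier       = V n
    ; _≈_           = _≃_
    ; isEquivalence = record
      { refl  = λ {x} → ≃-refl x
      ; sym   = λ {x} {y} → ≃-sym x y
      ; trans = λ {x} {y} {z} → ≃-trans x y z
      }
    }

  elem-cong : (x y : V n) → x ≃ y → (e : Elems x) → Σ (Elems y) λ e' → elem x e ≃ elem y e'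
  elem-cong (atom i)  (atom j)  i≡j     _ = tt , i≡j
  elem-cong (sup A f) (sup B g) (f⊆g , _) a = f⊆g a

  act-cong : (g : Perm n) (x y : V n) → x ≃ y → act g x ≃ act g y
  act-cong g (atom i)  (atom j)  i≡j = cong (g ⟨$⟩ʳ_) i≡j
  act-cong g (sup A f) (sup B h) (f⊆h , h⊆f) =
    (λ a → let (b , fa≃hb) = f⊆h a in b , act-cong g (f a) (h b) fa≃hb) ,
    (λ b → let (a , fa≃hb) = h⊆f b in a , act-cong g (f a) (h b) fa≃hb)

  act-act : (a b a' b' : Perm n) → (∀ i → a ⟨$⟩ʳ (b ⟨$⟩ʳ i) ≡ a' ⟨$⟩ʳ (b' ⟨$⟩ʳ i)) →
            (x : V n) → act a (act b x) ≃ act a' (act b' x)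
  act-act a b a' b' ab≗a'b' (atom i)  = ab≗a'b' i
  act-act a b a' b' ab≗a'b' (sup A f) =
    (λ z → z , act-act a b a' b' ab≗a'b' (f z)) , (λ z → z , act-act a b a' b' ab≗a'b' (f z))

  elems-act : (π : Perm n) (x : V n) →
              sup (Elems x) (act π ∘ elem x) ≃ sup (Elems (act π x)) (elem (act π x))
  elems-act π (atom i)  = (λ _ → tt , refl) , (λ _ → tt , refl)
  elems-act π (sup A f) = (λ a → a , ≃-refl (act π (f a))) , (λ a → a , ≃-refl (act π (f a)))

  -- In the union, an atom a counts as the singleton {a}.
  ⋃ : (A : Set) → (A → V n) → V n
  ⋃ A f = sup (Σ A (Elems ∘ f)) λ (a , e) → elem (f a) e

  ⋃-cong : {A B : Set} (f : A → V n) (g : B → V n) → sup A f ≃ sup B g → ⋃ A f ≃ ⋃ B g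
  ⋃-cong f g (f⊆g , g⊆f) =
    (λ (a , e) → let (b , fa≃gb) = f⊆g a ; (e' , fae≃gbe') = elem-cong (f a) (g b) fa≃gb e
                 in (b , e') , fae≃gbe') ,
    (λ (b , e') → let (a , fa≃gb) = g⊆f b
                      (e , gbe'≃fae) = elem-cong (g b) (f a) (≃-sym (f a) (g b) fa≃gb) e'
                  in (a , e) , ≃-sym (elem (g b) e') (elem (f a) e) gbe'≃fae)

  act-⋃ : (π : Perm n) (A : Set) (f : A → V n) → act π (⋃ A f) ≃ ⋃ A (act π ∘ f)
  act-⋃ π A f =
    (λ (a , e) → let (e' , πe≃e') = proj₁ (elems-act π (f a)) e in (a , e') , πe≃e') ,
    (λ (a , e') → let (e , πe≃e') = proj₂ (elems-act π (f a)) e' in (a , e) , πe≃e')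

  act-sup-commuting : (π : Perm n) (P : Perm n → Set) → CommutesWith π P →
    (F F' : Perm n → V n) →
    (∀ g g' → (∀ i → π ⟨$⟩ʳ (g ⟨$⟩ʳ i) ≡ g' ⟨$⟩ʳ (π ⟨$⟩ʳ i)) → act π (F g) ≃ F' g') →
    act π (sup (Σ (Perm n) P) (F ∘ proj₁)) ≃ sup (Σ (Perm n) P) (F' ∘ proj₁)
  act-sup-commuting π P (πP⊆Pπ , Pπ⊆πP) F F' conj =
    (λ (g , g∈P) → let (g' , g'∈P , πg≗g'π) = πP⊆Pπ g g∈P
                   in (g' , g'∈P) , conj g g' πg≗g'π) ,
    (λ (g' , g'∈P) → let (g , g∈P , g'π≗πg) = Pπ⊆πP g' g'∈P
                     in (g , g∈P) , conj g g' (sym ∘ g'π≗πg))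

module _ {n m : ℕ} (colour : Fin n → Fin m) where

  ColourPreserving : Perm n → Set
  ColourPreserving π = ∀ i → colour (π ⟨$⟩ʳ i) ≡ colour i

  ColourPreserving-flip : (π : Perm n) → ColourPreserving π → ColourPreserving (flip π)
  ColourPreserving-flip π pres i = trans (sym (pres (π ⟨$⟩ˡ i))) (cong colour (inverseʳ π))

  module _ {k : ℕ} where

    MapsTo : (Fin n → Fin n) → Molecule k n → Molecule k n → Set
    MapsTo f τ τ' = ∀ p → at τ' p ≡ f (at τ p)

    ρ-MapsTo : (f : Fin n → Fin n) {τ σ τ' σ' : Molecule k n} →
               MapsTo f τ τ' → MapsTo f σ σ' → ∀ i p → ρ τ' σ' i p ≡ f (ρ τ σ i p)
    ρ-MapsTo f τ↦τ' σ↦σ' 0F = τ↦τ'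
    ρ-MapsTo f τ↦τ' σ↦σ' 1F = σ↦σ'

    IsConf-MapsTo : (E : Conf k m) (π : Perm n) → ColourPreserving π →
                    {τ σ τ' σ' : Molecule k n} →
                    MapsTo (π ⟨$⟩ʳ_) τ τ' → MapsTo (π ⟨$⟩ʳ_) σ σ' →
                    IsConf colour E τ σ → IsConf colour E τ' σ'
    IsConf-MapsTo E π pres {τ} {σ} {τ'} {σ'} τ↦τ' σ↦σ' (rel≡ , col≡) =
      (λ i p j q → trans (rel≡ i p j q) (trans
        (does-≟-⟨$⟩ʳ (ρ τ σ i p) (ρ τ σ j q))
        (cong₂ (λ x y → does (x ≟ y)) (sym (ρ↦ i p)) (sym (ρ↦ j q))))) ,
      (λ i p → trans (col≡ i p) (trans (sym (pres _)) (cong colour (sym (ρ↦ i p)))))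
      where
      ρ↦ : ∀ i p → ρ τ' σ' i p ≡ π ⟨$⟩ʳ ρ τ σ i p
      ρ↦ = ρ-MapsTo (π ⟨$⟩ʳ_) τ↦τ' σ↦σ'
      does-≟-⟨$⟩ʳ : ∀ x y → does (x ≟ y) ≡ does (π ⟨$⟩ʳ x ≟ π ⟨$⟩ʳ y)
      does-≟-⟨$⟩ʳ x y = does-⇔ (mk⇔ (cong (π ⟨$⟩ʳ_)) (Injection.injective (↔⇒↣ π)))
                                (x ≟ y) (π ⟨$⟩ʳ x ≟ π ⟨$⟩ʳ y)

    star-MapsTo : (π : Perm n) → ColourPreserving π →
                  (φ : Form k m) {τ τ' : Molecule k n} → MapsTo (π ⟨$⟩ʳ_) τ τ' →
                  star colour φ τ' ≃ act π (star colour φ τ)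
    star-MapsTo π pres (c p)         τ↦τ' = τ↦τ' p
    star-MapsTo π pres (set r φ E) {τ} {τ'} τ↦τ' =
      (λ (i , υ , υτ'∈Eᵢ) →
         (i , permMol (flip π) υ ,
          IsConf-MapsTo (E i) (flip π) (ColourPreserving-flip π pres) (λ _ → refl) τ'↦τ υτ'∈Eᵢ) ,
         star-MapsTo π pres (φ i) (λ _ → sym (inverseʳ π))) ,
      (λ (i , υ , υτ∈Eᵢ) →
         (i , permMol π υ , IsConf-MapsTo (E i) π pres (λ _ → refl) τ↦τ' υτ∈Eᵢ) ,
         star-MapsTo π pres (φ i) (λ _ → refl))
      where
      τ'↦τ : MapsTo (π ⟨$⟩ˡ_) τ' τ
      τ'↦τ p = trans (sym (inverseˡ π)) (cong (π ⟨$⟩ˡ_) (sym (τ↦τ' p)))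

module _ {n m k : ℕ} {colour : Fin n → Fin m} {A : AutGroup colour} (O : OrbitForm k A) where
  open OrbitForm O

  φ*H : Molecule k n → Σ (Perm n) H → V n
  φ*H σ (h , _) = star colour φ (permMol h σ)

  act-⋃-φ*H : (π : Perm n) → ColourPreserving colour π → CommutesWith π H →
              (σ : Molecule k n) → act π (⋃ _ (φ*H σ)) ≃ ⋃ _ (φ*H (permMol π σ))
  act-⋃-φ*H π pres π↔H σ = begin
    act π (⋃ _ (φ*H σ))          ≈⟨ act-⋃ π _ (φ*H σ) ⟩
    ⋃ _ (act π ∘ φ*H σ)          ≈⟨ ⋃-cong (act π ∘ φ*H σ) (φ*H (permMol π σ)) act-φ*H ⟩
    ⋃ _ (φ*H (permMol π σ))      ∎
    where
    open import Relation.Binary.Reasoning.Setoid V-setoid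
    act-φ*H : sup _ (act π ∘ φ*H σ) ≃ sup _ (φ*H (permMol π σ))
    act-φ*H = act-sup-commuting π H π↔H _ _ λ h h' πh≗h'π →
      ≃-sym _ _ (star-MapsTo colour π pres φ (sym ∘ πh≗h'π ∘ at σ))

  act-orbitStar : (π : Perm n) → ColourPreserving colour π →
                  CommutesWith π G → CommutesWith π H →
                  (σ : Molecule k n) → act π (orbitStar O σ) ≃ orbitStar O (permMol π σ)
  act-orbitStar π pres π↔G π↔H σ =
    act-sup-commuting π G π↔G _ _ λ g g' πg≗g'π → begin
      act π (act g (⋃ _ (φ*H σ)))      ≈⟨ act-act π g g' π πg≗g'π _ ⟩
      act g' (act π (⋃ _ (φ*H σ)))     ≈⟨ act-cong g' _ _ (act-⋃-φ*H π pres π↔H σ) ⟩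
      act g' (⋃ _ (φ*H (permMol π σ))) ∎
    where open import Relation.Binary.Reasoning.Setoid V-setoid

lemma6 : {n m k : ℕ} → 1 ≤ k → (colour : Fin n → Fin m) → (A : AutGroup colour) →
         (π : Perm n) → AutGroup.member A π →
         (O : OrbitForm k A) → (σ : Molecule k n) →
         act π (orbitStar O σ) ≃ orbitStar O (permMol π σ)
lemma6 _ colour A π π∈A O σ =
  act-orbitStar O π (preserves π π∈A) (G-comm π π∈A) (H-comm π π∈A) σ
  where
  open AutGroup A
  open OrbitForm O
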